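{- A blocked process is either stuck, final, $\delta$-like, or of one of the following forms, where $x$ is a $\lambda$-variable, $a$ a term variable, $v$ a value, $\pi$ a stack: $x.l\ast\pi$; $x\ast v.\pi$; $\mathrm{case}_x[C_i[x_i]\to t_i]_{i\in I}\ast\pi$; $a\ast\pi$.
   Context: Fix pairwise disjoint countably infinite sets of $\lambda$-variables ($x,y,\dots$), stack variables ($\alpha,\beta,\dots$), term variables ($a,b,\dots$), and countable sets of labels $l$ and constructors $C$. Values, terms, stacks, processes: $v,w::=x\mid\lambda x\,t\mid C[v]\mid\{l_i=v_i\}_{i\in I}$; $t,u::=a\mid v\mid t\,u\mid\mu\alpha\,t\mid p\mid v.l\mid\mathrm{case}_v[C_i[x_i]\to t_i]_{i\in I}\mid\delta_{v,w}$; $\pi::=\alpha\mid v.\pi\mid[t]\pi$; $p::=t\ast\pi$; $I$ finite; $\lambda x$, $\mu\alpha$ and the $x_i$ in case branches are binders, term variables are never bound. A substitution maps $\lambda$-variables to values, stack variables to stacks and term variables to terms (capture-avoiding). $\succ$ is the smallest relation on processes with: $t\,u\ast\pi\succ u\ast[t]\pi$; $v\ast[t]\pi\succ t\ast v.\pi$; $\lambda x\,t\ast v.\pi\succ t[x:=v]\ast\pi$; $\mu\alpha\,t\ast\pi\succ t[\alpha:=\pi]\ast\pi$; $p\ast\pi\succ p$; $\{l_i=v_i\}_{i\in I}.l_k\ast\pi\succ v_k\ast\pi$ ($k\in I$); $\mathrm{case}_{C_k[v]}[C_i[x_i]\to t_i]_{i\in I}\ast\pi\succ t_k[x_k:=v]\ast\pi$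 ($k\in I$). A process $p$ is: final if $p=v\ast\alpha$ for a value $v$ and stack variable $\alpha$; $\delta$-like if $p=\delta_{v,w}\ast\pi$; blocked if there is no $q$ with $p\succ q$; stuck if it is neither final nor $\delta$-like and $p\sigma$ is blocked for every substitution $\sigma$. -}

module Defs where

open import Data.Nat using (ℕ; zero; suc)
open import Data.Product using (Σ; _×_; _,_)
open import Data.Sum using (_⊎_)
open import Data.Empty using (⊥)
open import Relation.Nullary using (¬_)
open import Relation.Binary.PropositionalEquality using (_≡_)
open import Function using (id; _∘_)

-- Syntax in de Bruijn style (two independent index spaces: λ-variables
-- and stack variables); term variables are never bound, so they are names.

Label : Set
Label = ℕ

Con : Set
Con = ℕ

mutual
  data Val : Set where
    vvar : ℕ → Val
    lam  : Tm → Val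
    con  : Con → Val → Val
    rcd  : Fields → Val

  data Fields : Set where
    fnil  : Fields
    fcons : Label → Val → Fields → Fields

  data Tm : Set where
    tvar  : ℕ → Tm
    val   : Val → Tm
    app   : Tm → Tm → Tm
    mu    : Tm → Tm
    proc  : Proc → Tm
    proj  : Val → Label → Tm
    case  : Val → Branches → Tm
    delta : Val → Val → Tm

  -- finite families [C_i[x_i] → t_i]_{i∈I}; each t_i binds one λ-variable
  data Branches : Set where
    bnil  : Branches
    bcons : Con → Tm → Branches → Branches

  data Stk : Set where
    svar  : ℕ → Stk
    push  : Val → Stk → Stk
    frame : Tm → Stk → Stk

  data Proc : Set where
    _∗_ : Tm → Stk → Proc

infix 4 _∗_

ext : (ℕ → ℕ) → ℕ → ℕ
ext ρ zero = zero
ext ρ (suc n) = suc (ρ n)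

mutual
  renV : (ℕ → ℕ) → (ℕ → ℕ) → Val → Val
  renV ρ κ (vvar x) = vvar (ρ x)
  renV ρ κ (lam t) = lam (renT (ext ρ) κ t)
  renV ρ κ (con C v) = con C (renV ρ κ v)
  renV ρ κ (rcd fs) = rcd (renF ρ κ fs)

  renF : (ℕ → ℕ) → (ℕ → ℕ) → Fields → Fields
  renF ρ κ fnil = fnil
  renF ρ κ (fcons l v fs) = fcons l (renV ρ κ v) (renF ρ κ fs)

  renT : (ℕ → ℕ) → (ℕ → ℕ) → Tm → Tm
  renT ρ κ (tvar a) = tvar a
  renT ρ κ (val v) = val (renV ρ κ v)
  renT ρ κ (app t u) = app (renT ρ κ t) (renT ρ κ u)
  renT ρ κ (mu t) = mu (renT ρ (ext κ) t)
  renT ρ κ (proc p) = proc (renP ρ κ p)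
  renT ρ κ (proj v l) = proj (renV ρ κ v) l
  renT ρ κ (case v bs) = case (renV ρ κ v) (renB ρ κ bs)
  renT ρ κ (delta v w) = delta (renV ρ κ v) (renV ρ κ w)

  renB : (ℕ → ℕ) → (ℕ → ℕ) → Branches → Branches
  renB ρ κ bnil = bnil
  renB ρ κ (bcons C t bs) = bcons C (renT (ext ρ) κ t) (renB ρ κ bs)

  renS : (ℕ → ℕ) → (ℕ → ℕ) → Stk → Stk
  renS ρ κ (svar α) = svar (κ α)
  renS ρ κ (push v π) = push (renV ρ κ v) (renS ρ κ π)
  renS ρ κ (frame t π) = frame (renT ρ κ t) (renS ρ κ π)

  renP : (ℕ → ℕ) → (ℕ → ℕ) → Proc → Proc
  renP ρ κ (t ∗ π) = renT ρ κ t ∗ renS ρ κ π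

record Subst : Set where
  field
    sval : ℕ → Val
    sstk : ℕ → Stk
    stm  : ℕ → Tm
open Subst public

liftλ : Subst → Subst
liftλ σ = record { sval = f ; sstk = renS suc id ∘ sstk σ ; stm = renT suc id ∘ stm σ }
  where
  f : ℕ → Val
  f zero = vvar zero
  f (suc n) = renV suc id (sval σ n)

liftμ : Subst → Subst
liftμ σ = record { sval = renV id suc ∘ sval σ ; sstk = g ; stm = renT id suc ∘ stm σ }
  where
  g : ℕ → Stk
  g zero = svar zero
  g (suc n) = renS id suc (sstk σ n)

mutual
  subV : Subst → Val → Val
  subV σ (vvar x) = sval σ x
  subV σ (lam t) = lam (subT (liftλ σ) t)
  subV σ (con C v) = con C (subV σ v)
  subV σ (rcd fs) = rcd (subF σ fs)

  subF : Subst → Fields → Fields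
  subF σ fnil = fnil
  subF σ (fcons l v fs) = fcons l (subV σ v) (subF σ fs)

  subT : Subst → Tm → Tm
  subT σ (tvar a) = stm σ a
  subT σ (val v) = val (subV σ v)
  subT σ (app t u) = app (subT σ t) (subT σ u)
  subT σ (mu t) = mu (subT (liftμ σ) t)
  subT σ (proc p) = proc (subP σ p)
  subT σ (proj v l) = proj (subV σ v) l
  subT σ (case v bs) = case (subV σ v) (subB σ bs)
  subT σ (delta v w) = delta (subV σ v) (subV σ w)

  subB : Subst → Branches → Branches
  subB σ bnil = bnil
  subB σ (bcons C t bs) = bcons C (subT (liftλ σ) t) (subB σ bs)

  subS : Subst → Stk → Stk
  subS σ (svar α) = sstk σ α
  subS σ (push v π) = push (subV σ v) (subS σ π)
  subS σ (frame t π) = frame (subT σ t) (subS σ π)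

  subP : Subst → Proc → Proc
  subP σ (t ∗ π) = subT σ t ∗ subS σ π

idSubst : Subst
idSubst = record { sval = vvar ; sstk = svar ; stm = tvar }

openλ : Val → Subst
openλ v = record idSubst { sval = f }
  where
  f : ℕ → Val
  f zero = v
  f (suc n) = vvar n

openμ : Stk → Subst
openμ π = record idSubst { sstk = g }
  where
  g : ℕ → Stk
  g zero = π
  g (suc n) = svar n

data _∋ᶠ_↦_ : Fields → Label → Val → Set where
  here  : ∀ {l v fs} → fcons l v fs ∋ᶠ l ↦ v
  there : ∀ {l v l' v' fs} → fs ∋ᶠ l ↦ v → fcons l' v' fs ∋ᶠ l ↦ v

data _∋ᵇ_↦_ : Branches → Con → Tm → Set where
  here  : ∀ {C t bs} → bcons C t bs ∋ᵇ C ↦ t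
  there : ∀ {C t C' t' bs} → bs ∋ᵇ C ↦ t → bcons C' t' bs ∋ᵇ C ↦ t

infix 3 _≻_
data _≻_ : Proc → Proc → Set where
  ≻-app   : ∀ {t u π} → app t u ∗ π ≻ u ∗ frame t π
  ≻-val   : ∀ {v t π} → val v ∗ frame t π ≻ t ∗ push v π
  ≻-β     : ∀ {t v π} → val (lam t) ∗ push v π ≻ subT (openλ v) t ∗ π
  ≻-μ     : ∀ {t π} → mu t ∗ π ≻ subT (openμ π) t ∗ π
  ≻-proc  : ∀ {p π} → proc p ∗ π ≻ p
  ≻-proj  : ∀ {fs l v π} → fs ∋ᶠ l ↦ v → proj (rcd fs) l ∗ π ≻ val v ∗ π
  ≻-case  : ∀ {C v bs t π} → bs ∋ᵇ C ↦ t →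
            case (con C v) bs ∗ π ≻ subT (openλ v) t ∗ π

Final : Proc → Set
Final p = Σ Val λ v → Σ ℕ λ α → p ≡ (val v ∗ svar α)

DeltaLike : Proc → Set
DeltaLike p = Σ Val λ v → Σ Val λ w → Σ Stk λ π → p ≡ (delta v w ∗ π)

Blocked : Proc → Set
Blocked p = ¬ (Σ Proc λ q → p ≻ q)

Stuck : Proc → Set
Stuck p = ¬ Final p × ¬ DeltaLike p × ((σ : Subst) → Blocked (subP σ p))

ProjVar : Proc → Set
ProjVar p = Σ ℕ λ x → Σ Label λ l → Σ Stk λ π → p ≡ (proj (vvar x) l ∗ π)

VarPush : Proc → Set
VarPush p = Σ ℕ λ x → Σ Val λ v → Σ Stk λ π → p ≡ (val (vvar x) ∗ push v π)

CaseVar : Proc → Set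
CaseVar p = Σ ℕ λ x → Σ Branches λ bs → Σ Stk λ π → p ≡ (case (vvar x) bs ∗ π)

TmVar : Proc → Set
TmVar p = Σ ℕ λ a → Σ Stk λ π → p ≡ (tvar a ∗ π)

-- Substitution preserves the head constructor of every non-variable value,
-- and it preserves the labels of a record and the constructors of a case.
-- So if a blocked process is not headed by a λ-variable or a term variable
-- (and is neither final nor δ-like), every rule fails on all of its
-- substitution instances for the same reason it fails on the process itself.
module Submission where

open import Defs
open import Data.Sum using (_⊎_; inj₁; inj₂)
open import Data.Product using (∃; _,_; map₂)
open import Relation.Binary.PropositionalEquality using (refl)
open import Data.Empty using (⊥-elim)

∋ᶠ-subF⁻ : ∀ {σ l v} fs → subF σ fs ∋ᶠ l ↦ v → ∃ (fs ∋ᶠ l ↦_)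
∋ᶠ-subF⁻ (fcons _ w _)  here      = w , here
∋ᶠ-subF⁻ (fcons _ _ fs) (there m) = map₂ there (∋ᶠ-subF⁻ fs m)

∋ᵇ-subB⁻ : ∀ {σ C t} bs → subB σ bs ∋ᵇ C ↦ t → ∃ (bs ∋ᵇ C ↦_)
∋ᵇ-subB⁻ (bcons _ u _)  here      = u , here
∋ᵇ-subB⁻ (bcons _ _ bs) (there m) = map₂ there (∋ᵇ-subB⁻ bs m)

data NonVar : Val → Set where
  lam : ∀ t → NonVar (lam t)
  con : ∀ C v → NonVar (con C v)
  rcd : ∀ fs → NonVar (rcd fs)

data VarView : Val → Set where
  var    : ∀ x → VarView (vvar x)
  nonVar : ∀ {v} → NonVar v → VarView v

varView : (v : Val) → VarView v
varView (vvar x)  = var x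
varView (lam t)   = nonVar (lam t)
varView (con C v) = nonVar (con C v)
varView (rcd fs)  = nonVar (rcd fs)

push-stuck : ∀ {v w π} → NonVar v → Blocked (val v ∗ push w π) →
             Stuck (val v ∗ push w π)
push-stuck nv bl = (λ { (_ , _ , ()) }) , (λ { (_ , _ , _ , ()) }) , blocked-sub nv bl
  where
  blocked-sub : ∀ {v w π} → NonVar v → Blocked (val v ∗ push w π) →
                (σ : Subst) → Blocked (subP σ (val v ∗ push w π))
  blocked-sub (lam t)   bl σ _       = bl (_ , ≻-β)
  blocked-sub (con C v) bl σ (_ , ())
  blocked-sub (rcd fs)  bl σ (_ , ())

proj-stuck : ∀ {v l π} → NonVar v → Blocked (proj v l ∗ π) → Stuck (proj v l ∗ π)
proj-stuck nv bl = (λ { (_ , _ , ()) }) , (λ { (_ , _ , _ , ()) }) , blocked-sub nv bl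
  where
  blocked-sub : ∀ {v l π} → NonVar v → Blocked (proj v l ∗ π) →
                (σ : Subst) → Blocked (subP σ (proj v l ∗ π))
  blocked-sub (lam t)   bl σ (_ , ())
  blocked-sub (con C v) bl σ (_ , ())
  blocked-sub (rcd fs)  bl σ (_ , ≻-proj m) with ∋ᶠ-subF⁻ fs m
  ... | _ , m′ = bl (_ , ≻-proj m′)

case-stuck : ∀ {v bs π} → NonVar v → Blocked (case v bs ∗ π) → Stuck (case v bs ∗ π)
case-stuck nv bl = (λ { (_ , _ , ()) }) , (λ { (_ , _ , _ , ()) }) , blocked-sub nv bl
  where
  blocked-sub : ∀ {v bs π} → NonVar v → Blocked (case v bs ∗ π) →
                (σ : Subst) → Blocked (subP σ (case v bs ∗ π))
  blocked-sub             (lam t)   bl σ (_ , ())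
  blocked-sub             (rcd fs)  bl σ (_ , ())
  blocked-sub {bs = bs}   (con C v) bl σ (_ , ≻-case m) with ∋ᵇ-subB⁻ bs m
  ... | _ , m′ = bl (_ , ≻-case m′)

lemma4 : (p : Proc) → Blocked p →
    Stuck p ⊎ Final p ⊎ DeltaLike p ⊎ ProjVar p ⊎ VarPush p ⊎ CaseVar p ⊎ TmVar p
lemma4 (tvar a ∗ π)        _  = inj₂ (inj₂ (inj₂ (inj₂ (inj₂ (inj₂ (a , π , refl))))))
lemma4 (val v ∗ svar α)    _  = inj₂ (inj₁ (v , α , refl))
lemma4 (val v ∗ frame t π) bl = ⊥-elim (bl (_ , ≻-val))
lemma4 (val v ∗ push w π)  bl with varView v
... | var x     = inj₂ (inj₂ (inj₂ (inj₂ (inj₁ (x , w , π , refl)))))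
... | nonVar nv = inj₁ (push-stuck nv bl)
lemma4 (app t u ∗ π)       bl = ⊥-elim (bl (_ , ≻-app))
lemma4 (mu t ∗ π)          bl = ⊥-elim (bl (_ , ≻-μ))
lemma4 (proc p ∗ π)        bl = ⊥-elim (bl (_ , ≻-proc))
lemma4 (proj v l ∗ π)      bl with varView v
... | var x     = inj₂ (inj₂ (inj₂ (inj₁ (x , l , π , refl))))
... | nonVar nv = inj₁ (proj-stuck nv bl)
lemma4 (case v bs ∗ π)     bl with varView v
... | var x     = inj₂ (inj₂ (inj₂ (inj₂ (inj₂ (inj₁ (x , bs , π , refl))))))
... | nonVar nv = inj₁ (case-stuck nv bl)
lemma4 (delta v w ∗ π)     _  = inj₂ (inj₂ (inj₁ (v , w , π , refl)))
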